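{- Let $D$ be a plane oriented graph whose underlying undirected graph is connected, and let $X$ be an inclusion-minimal multicompletion of $D$ such that $D+X$ is strongly connected. Then no arc of $X$ has both endpoints in a single strong component of $D$, and for any two distinct strong components of $D$, at most one arc of $X$ joins them (in either direction). In particular, $X$ is a solution of $D$.
   Context: An oriented graph has no loops, parallel arcs or digons; plane means with a fixed plane embedding. An angle of a face $F$ is a vertex together with its two consecutive boundary arcs along $F$; $W(D)$ is the set of all angles of all faces. A multicompletion of $D$ is a multiset $X$ of pairs in $W(D)^2$, each pair $(w,w')$ being an arc embedded inside a common face between angles $w$ and $w'$, such that $D+X$ (the multidigraph with arcs $A(D)$ plus those of $X$) is a plane multidigraph and every digon, pair of parallel arcs, or loop of $D+X$ consists entirely of arcs of $X$. A completion is a set of such embedded arcs with $D+X$ plane and oriented; a solution is a completion with $D+X$ strongly connected. -}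

module Defs where

open import Data.Nat using (ℕ; zero; suc; _+_; _≤_; _<_)
open import Data.Fin using (Fin)
open import Data.Bool using (Bool; true; false; not)
open import Data.Product using (Σ; ∃; ∃-syntax; _×_; _,_; proj₁; proj₂)
open import Data.Sum using (_⊎_)
open import Relation.Binary.PropositionalEquality using (_≡_; _≢_)
open import Relation.Nullary using (¬_)
open import Relation.Binary.Construct.Closure.ReflexiveTransitive using (Star)

iter : {A : Set} → (A → A) → ℕ → A → A
iter f zero    x = x
iter f (suc k) x = f (iter f k x)

-- Darts: arc e together with an end (false = tail end, true = head end).

Dart : ℕ → Set
Dart m = Fin m × Bool

flip : {m : ℕ} → Dart m → Dart m
flip (e , b) = (e , not b)

dartVertex : {n m : ℕ} → (Fin m → Fin n) → (Fin m → Fin n) → Dart m → Fin n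
dartVertex tl hd (e , false) = tl e
dartVertex tl hd (e , true)  = hd e

-- A plane oriented graph, given combinatorially by a rotation system
-- (the standard combinatorial encoding of a plane embedding of a
-- connected graph).  Vertices are Fin n, arcs are Fin m.
--
-- σ rotates the darts around their common vertex (the cyclic order of
-- arcs at a vertex in the embedding).  An angle is identified with a
-- dart d: the corner at the vertex of d between the arc of d and the
-- arc of σ d (two consecutive boundary arcs of a face).  The angle
-- following d along its face is ψ d = flip (σ d).  Faces are the
-- ψ-orbits.  Genus 0 (planarity) is expressed by Euler's formula
-- n - m + f = 2, where f is the number of faces (ψ-orbits); this is the
-- correct criterion for connected graphs with at least one arc (a
-- connected graph without arcs is a single vertex and trivially plane).

record PlaneOrientedGraph : Set where
  field
    n m  : ℕ
    tail : Fin m → Fin n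
    head : Fin m → Fin n
    noLoop     : ∀ e → tail e ≢ head e
    noParallel : ∀ e e' → e ≢ e' → ¬ (tail e ≡ tail e' × head e ≡ head e')
    noDigon    : ∀ e e' → ¬ (tail e ≡ head e' × head e ≡ tail e')

  dv : Dart m → Fin n
  dv = dartVertex tail head

  field
    σ  : Dart m → Dart m
    σ⁻ : Dart m → Dart m
    σ-σ⁻ : ∀ d → σ (σ⁻ d) ≡ d
    σ⁻-σ : ∀ d → σ⁻ (σ d) ≡ d
    σ-vertex : ∀ d → dv (σ d) ≡ dv d
    σ-cyclic : ∀ d d' → dv d ≡ dv d' → ∃[ k ] iter σ k d ≡ d'

  ψ : Dart m → Dart m
  ψ d = flip (σ d)

  SameFace : Dart m → Dart m → Set
  SameFace a b = ∃[ k ] iter ψ k a ≡ b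

  field
    faces    : ℕ
    faceOf   : Dart m → Fin faces
    faceOf-onto : ∀ i → ∃[ d ] faceOf d ≡ i
    faceOf-same : ∀ a b → faceOf a ≡ faceOf b → SameFace a b
    same-faceOf : ∀ a b → SameFace a b → faceOf a ≡ faceOf b
    euler : m ≡ 0 ⊎ n + faces ≡ m + 2

module _ (D : PlaneOrientedGraph) where
  open PlaneOrientedGraph D

  Angle : Set
  Angle = Dart m

  Multi : Set
  Multi = Angle × Angle → ℕ

  -- x strictly inside the boundary walk of the face from angle a to
  -- the first subsequent occurrence of angle b
  Between : Angle → Angle → Angle → Set
  Between a b x =
    ∃[ k ] ∃[ l ] (0 < k × 0 < l × iter ψ k a ≡ x × iter ψ l x ≡ b
      × (∀ j → 0 < j → j < k + l → iter ψ j a ≢ b × iter ψ j a ≢ a))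

  Cross : Angle × Angle → Angle × Angle → Set
  Cross (a , b) (c , d) =
    a ≢ b × a ≢ c × a ≢ d × b ≢ c × b ≢ d × c ≢ d
    × ((Between a b c × Between b a d) ⊎ (Between b a c × Between a b d))

  ArcD : Fin n → Fin n → Set
  ArcD u v = ∃[ e ] (tail e ≡ u × head e ≡ v)

  UArcD : Fin n → Fin n → Set
  UArcD u v = ∃[ e ] ((tail e ≡ u × head e ≡ v) ⊎ (head e ≡ u × tail e ≡ v))

  UnderlyingConnected : Set
  UnderlyingConnected = ∀ u v → Star UArcD u v

  ArcDX : Multi → Fin n → Fin n → Set
  ArcDX X u v = ArcD u v ⊎ (∃[ p ] (0 < X p × dv (proj₁ p) ≡ u × dv (proj₂ p) ≡ v))

  StronglyConnectedDX : Multi → Set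
  StronglyConnectedDX X = ∀ u v → Star (ArcDX X) u v

  record IsMulticompletion (X : Multi) : Set where
    field
      -- each arc of X is embedded inside a common face between its angles
      inFace   : ∀ p → 0 < X p → SameFace (proj₁ p) (proj₂ p)
      -- D + X is plane: arcs inside a face pairwise do not cross
      noCross  : ∀ p q → 0 < X p → 0 < X q → ¬ Cross p q
      -- loops, digons and parallel pairs of D + X consist only of X-arcs
      -- (D itself is oriented, so only mixed D/X pairs need excluding)
      noMixedParallel : ∀ p e → 0 < X p →
        ¬ (dv (proj₁ p) ≡ tail e × dv (proj₂ p) ≡ head e)
      noMixedDigon : ∀ p e → 0 < X p →
        ¬ (dv (proj₁ p) ≡ head e × dv (proj₂ p) ≡ tail e)

  record IsCompletion (X : Multi) : Set where
    field
      multicompletion : IsMulticompletion X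
      isSet       : ∀ p → X p ≤ 1
      noLoopX     : ∀ p → 0 < X p → dv (proj₁ p) ≢ dv (proj₂ p)
      noParallelX : ∀ p q → 0 < X p → 0 < X q → p ≢ q →
        ¬ (dv (proj₁ p) ≡ dv (proj₁ q) × dv (proj₂ p) ≡ dv (proj₂ q))
      noDigonX    : ∀ p q → 0 < X p → 0 < X q →
        ¬ (dv (proj₁ p) ≡ dv (proj₂ q) × dv (proj₂ p) ≡ dv (proj₁ q))

  IsSolution : Multi → Set
  IsSolution X = IsCompletion X × StronglyConnectedDX X

  _⊏_ : Multi → Multi → Set
  Y ⊏ X = (∀ p → Y p ≤ X p) × (∃[ p ] Y p < X p)

  MinimalSCMulticompletion : Multi → Set
  MinimalSCMulticompletion X =
    IsMulticompletion X × StronglyConnectedDX X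
    × (∀ Y → Y ⊏ X → ¬ (IsMulticompletion Y × StronglyConnectedDX Y))

  SameSC : Fin n → Fin n → Set
  SameSC u v = Star ArcD u v × Star ArcD v u

  Joins : Fin n → Fin n → Angle × Angle → Set
  Joins u v p =
    (SameSC u (dv (proj₁ p)) × SameSC v (dv (proj₂ p)))
    ⊎ (SameSC v (dv (proj₁ p)) × SameSC u (dv (proj₂ p)))

{-# OPTIONS --safe #-}

-- Deleting one copy of an arc of X leaves a multicompletion, so by minimality the arc has no
-- bypass: no path from its tail to its head in D + X minus that copy. A D-path inside a strong
-- component, a second copy, or a second arc between two components in the same direction would
-- be such a bypass. For arcs p : A → B and q : B → A, delete both: by strong connectivity of
-- D + X every vertex is then reached from the head of q or of p, and reaches the tail of p or
-- of q. Reached from A and reaching B would bypass p, reached from B and reaching A would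
-- bypass q; hence the vertices reached from A are closed under arcs of D in both directions,
-- and connectivity of the underlying graph puts the tail of q among them, bypassing p.
module Submission where

open import Defs
open import Data.Nat using (pred; _<_; _≤_; _≤?_; z≤n; s≤s; >-nonZero)
open import Data.Nat.Properties using (≤-refl; ≤-antisym; <-≤-trans; ≰⇒>; pred[n]≤n; pred-mono-≤)
open import Data.Nat.Properties using (suc[m]≤n⇒m≤pred[n]; m≤pred[n]⇒suc[m]≤n)
open import Data.Fin using (Fin)
open import Data.Fin.Properties using () renaming (_≟_ to _≟ᶠ_)
open import Data.Bool.Properties using () renaming (_≟_ to _≟ᵇ_)
open import Data.Product using (_×_; _,_; proj₁; proj₂)
open import Data.Product.Properties using (≡-dec)
open import Data.Sum using (_⊎_; inj₁; inj₂)
import Data.Sum as Sum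
open import Data.Empty using (⊥; ⊥-elim)
open import Function using (_∘_; id)
open import Relation.Binary.Core using (Rel; _⇒_)
open import Relation.Binary.Definitions using (DecidableEquality)
open import Relation.Binary.PropositionalEquality using (_≡_; _≢_; refl; sym; subst)
open import Relation.Nullary using (¬_; yes; no)
open import Relation.Binary.Construct.Closure.ReflexiveTransitive
  using (Star; ε; _◅_; _◅◅_; return; fold; map; _⋆)
open import Relation.Binary.Construct.Closure.ReflexiveTransitive.Properties using (reflexive)

module _ {I : Set} {T : I → I → Set} (S : I → Set) where

  Star-preserves : (∀ {x y} → T x y → S x → S y) → ∀ {x y} → Star T x y → S x → S y
  Star-preserves step = fold (λ x y → S x → S y) (λ t f → f ∘ step t) id

  Star-reflects : (∀ {x y} → T x y → S y → S x) → ∀ {x y} → Star T x y → S y → S x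
  Star-reflects step = fold (λ x y → S y → S x) (λ t f → step t ∘ f) id

module MinimalCompletion (D : PlaneOrientedGraph) where
  open PlaneOrientedGraph D

  Pair : Set
  Pair = Angle D × Angle D

  src tgt : Pair → Fin n
  src p = dv (proj₁ p)
  tgt p = dv (proj₂ p)

  _≟_ : DecidableEquality Pair
  _≟_ = ≡-dec (≡-dec _≟ᶠ_ _≟ᵇ_) (≡-dec _≟ᶠ_ _≟ᵇ_)

  removeOne : Multi D → Pair → Multi D
  removeOne X p r with r ≟ p
  ... | yes _ = pred (X r)
  ... | no _  = X r

  removeOne-≤ : ∀ X p r → removeOne X p r ≤ X r
  removeOne-≤ X p r with r ≟ p
  ... | yes _ = pred[n]≤n
  ... | no _  = ≤-refl

  removeOne-self : ∀ X p → removeOne X p p ≡ pred (X p)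
  removeOne-self X p with p ≟ p
  ... | yes _  = refl
  ... | no p≢p = ⊥-elim (p≢p refl)

  removeOne-other : ∀ X {p r} → r ≢ p → removeOne X p r ≡ X r
  removeOne-other X {p} {r} r≢p with r ≟ p
  ... | yes r≡p = ⊥-elim (r≢p r≡p)
  ... | no _    = refl

  removeOne-mono : ∀ {X Y} → (∀ r → Y r ≤ X r) → ∀ p r → removeOne Y p r ≤ removeOne X p r
  removeOne-mono Y≤X p r with r ≟ p
  ... | yes _ = pred-mono-≤ (Y≤X r)
  ... | no _  = Y≤X r

  removeOne-⊏ : ∀ X p → 0 < X p → _⊏_ D (removeOne X p) X
  removeOne-⊏ X p pos = removeOne-≤ X p , p , subst (_< X p) (sym (removeOne-self X p)) pred<
    where
      pred< : pred (X p) < X p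
      pred< = m≤pred[n]⇒suc[m]≤n {{>-nonZero pos}} ≤-refl

  removeOne-keeps : ∀ X {p r} → r ≢ p → 0 < X r → 0 < removeOne X p r
  removeOne-keeps X r≢p pos = subst (0 <_) (sym (removeOne-other X r≢p)) pos

  IsMulticompletion-mono : ∀ {X Y} → (∀ r → Y r ≤ X r) →
    IsMulticompletion D X → IsMulticompletion D Y
  IsMulticompletion-mono {X} {Y} Y≤X mc = record
    { inFace          = λ p → inFace p ∘ lift
    ; noCross         = λ p q pp pq → noCross p q (lift pp) (lift pq)
    ; noMixedParallel = λ p e → noMixedParallel p e ∘ lift
    ; noMixedDigon    = λ p e → noMixedDigon p e ∘ lift
    }
    where
      open IsMulticompletion mc
      lift : ∀ {r} → 0 < Y r → 0 < X r
      lift {r} pos = <-≤-trans pos (Y≤X r)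

  ArcDX-mono : ∀ {X Y} → (∀ r → Y r ≤ X r) → ArcDX D Y ⇒ ArcDX D X
  ArcDX-mono Y≤X (inj₁ e)                 = inj₁ e
  ArcDX-mono Y≤X (inj₂ (r , pos , s , t)) = inj₂ (r , <-≤-trans pos (Y≤X r) , s , t)

  arcX : ∀ {X} p → 0 < X p → ArcDX D X (src p) (tgt p)
  arcX p pos = inj₂ (p , pos , refl , refl)

  pathDX : ∀ {X} → Star (ArcD D) ⇒ Star (ArcDX D X)
  pathDX = map inj₁

  sameSC-path : ∀ {u x y} → SameSC D u x → SameSC D u y → Star (ArcD D) x y
  sameSC-path (_ , x⇝u) (u⇝y , _) = x⇝u ◅◅ u⇝y

  module Minimal {X : Multi D} (min : MinimalSCMulticompletion D X) where

    stronglyConnected : StronglyConnectedDX D X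
    stronglyConnected = proj₁ (proj₂ min)

    ¬bypass : ∀ {p} → 0 < X p → ¬ Star (ArcDX D (removeOne X p)) (src p) (tgt p)
    ¬bypass {p} pos bypass =
      proj₂ (proj₂ min) (removeOne X p) (removeOne-⊏ X p pos)
        ( IsMulticompletion-mono (removeOne-≤ X p) (proj₁ min)
        , λ u v → (reroute ⋆) (stronglyConnected u v))
      where
        reroute : ArcDX D X ⇒ Star (ArcDX D (removeOne X p))
        reroute (inj₁ e) = return (inj₁ e)
        reroute (inj₂ (r , pos-r , refl , refl)) with r ≟ p
        ... | yes refl = bypass
        ... | no r≢p   = return (arcX r (removeOne-keeps X r≢p pos-r))

    ¬D-bypass : ∀ {p} → 0 < X p → ¬ Star (ArcD D) (src p) (tgt p)
    ¬D-bypass pos = ¬bypass pos ∘ pathDX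

    multiplicity≤1 : ∀ p → X p ≤ 1
    multiplicity≤1 p with X p ≤? 1
    ... | yes X[p]≤1 = X[p]≤1
    ... | no X[p]≰1  = ⊥-elim (¬bypass (<-≤-trans (s≤s z≤n) 1<X[p]) (return (arcX p another-copy)))
      where
        1<X[p] : 1 < X p
        1<X[p] = ≰⇒> X[p]≰1
        another-copy : 0 < removeOne X p p
        another-copy = subst (0 <_) (sym (removeOne-self X p)) (suc[m]≤n⇒m≤pred[n] 1<X[p])

    ¬parallel : ∀ {p q} → p ≢ q → 0 < X p → 0 < X q →
      Star (ArcD D) (src q) (src p) → Star (ArcD D) (tgt p) (tgt q) → ⊥
    ¬parallel {p} {q} p≢q pos-p pos-q s t =
      ¬bypass pos-q (pathDX s ◅◅ arcX p (removeOne-keeps X p≢q pos-p) ◅ pathDX t)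

    ¬antiparallel : UnderlyingConnected D → ∀ {p q} → p ≢ q → 0 < X p → 0 < X q →
      Star (ArcD D) (src p) (tgt q) → Star (ArcD D) (src q) (tgt p) → ⊥
    ¬antiparallel connected {p} {q} p≢q pos-p pos-q a b =
      ¬FromA∧ToB (Star-preserves FromA FromA-step (connected (tgt q) (src q)) ε) ε
      where
        H : Rel (Fin n) _
        H = ArcDX D (removeOne (removeOne X p) q)

        H-arc : ∀ {r} → r ≢ p → r ≢ q → 0 < X r → H (src r) (tgt r)
        H-arc {r} r≢p r≢q pos = arcX r (removeOne-keeps _ r≢q (removeOne-keeps X r≢p pos))

        FromA FromB ToA ToB : Fin n → Set
        FromA x = Star H (tgt q) x
        FromB x = Star H (tgt p) x
        ToA   x = Star H x (src p)
        ToB   x = Star H x (src q)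

        ¬FromA∧ToB : ∀ {x} → FromA x → ToB x → ⊥
        ¬FromA∧ToB s t = ¬bypass pos-p
          (pathDX a ◅◅ map (ArcDX-mono (removeOne-≤ _ q)) (s ◅◅ t) ◅◅ pathDX b)

        ¬FromB∧ToA : ∀ {x} → FromB x → ToA x → ⊥
        ¬FromB∧ToA s t = ¬bypass pos-q
          (pathDX b ◅◅ map (ArcDX-mono H≤removeOne-q) (s ◅◅ t) ◅◅ pathDX a)
          where
            H≤removeOne-q : ∀ r → removeOne (removeOne X p) q r ≤ removeOne X q r
            H≤removeOne-q = removeOne-mono (removeOne-≤ X p) q

        extend-from : ∀ {x y} → H x y → FromA x ⊎ FromB x → FromA y ⊎ FromB y
        extend-from h = Sum.map (_◅◅ return h) (_◅◅ return h)

        extend-to : ∀ {x y} → H x y → ToA y ⊎ ToB y → ToA x ⊎ ToB x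
        extend-to h = Sum.map (h ◅_) (h ◅_)

        from-step : ∀ {x y} → ArcDX D X x y → FromA x ⊎ FromB x → FromA y ⊎ FromB y
        from-step (inj₁ e) = extend-from (inj₁ e)
        from-step (inj₂ (r , pos , refl , refl)) with r ≟ p | r ≟ q
        ... | yes refl | _        = λ _ → inj₂ ε
        ... | no _     | yes refl = λ _ → inj₁ ε
        ... | no r≢p   | no r≢q   = extend-from (H-arc r≢p r≢q pos)

        to-step : ∀ {x y} → ArcDX D X x y → ToA y ⊎ ToB y → ToA x ⊎ ToB x
        to-step (inj₁ e) = extend-to (inj₁ e)
        to-step (inj₂ (r , pos , refl , refl)) with r ≟ p | r ≟ q
        ... | yes refl | _        = λ _ → inj₁ ε
        ... | no _     | yes refl = λ _ → inj₂ ε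
        ... | no r≢p   | no r≢q   = extend-to (H-arc r≢p r≢q pos)

        from : ∀ y → FromA y ⊎ FromB y
        from y = Star-preserves (λ x → FromA x ⊎ FromB x) from-step
                   (stronglyConnected (tgt q) y) (inj₁ ε)

        to : ∀ x → ToA x ⊎ ToB x
        to x = Star-reflects (λ y → ToA y ⊎ ToB y) to-step (stronglyConnected x (src p)) (inj₁ ε)

        FromA-step : ∀ {x y} → UArcD D x y → FromA x → FromA y
        FromA-step (e , inj₁ (refl , refl)) s = s ◅◅ return (inj₁ (e , refl , refl))
        FromA-step (e , inj₂ (refl , refl)) s with from (tail e) | to (head e)
        ... | inj₁ s′ | _      = s′
        ... | inj₂ s′ | inj₁ t = ⊥-elim (¬FromB∧ToA s′ (inj₁ (e , refl , refl) ◅ t))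
        ... | inj₂ _  | inj₂ t = ⊥-elim (¬FromA∧ToB s t)

    ¬distinct-joining : UnderlyingConnected D → ∀ {u v p q} → p ≢ q →
      Joins D u v p → Joins D u v q → 0 < X p → 0 < X q → ⊥
    ¬distinct-joining _ p≢q (inj₁ (up , vp)) (inj₁ (uq , vq)) pos-p pos-q =
      ¬parallel p≢q pos-p pos-q (sameSC-path uq up) (sameSC-path vp vq)
    ¬distinct-joining _ p≢q (inj₂ (vp , up)) (inj₂ (vq , uq)) pos-p pos-q =
      ¬parallel p≢q pos-p pos-q (sameSC-path vq vp) (sameSC-path up uq)
    ¬distinct-joining connected p≢q (inj₁ (up , vp)) (inj₂ (vq , uq)) pos-p pos-q =
      ¬antiparallel connected p≢q pos-p pos-q (sameSC-path up uq) (sameSC-path vq vp)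
    ¬distinct-joining connected p≢q (inj₂ (vp , up)) (inj₁ (uq , vq)) pos-p pos-q =
      ¬antiparallel connected p≢q pos-p pos-q (sameSC-path vp vq) (sameSC-path uq up)

    joins-unique : UnderlyingConnected D → ∀ u v p q → Joins D u v p → Joins D u v q →
      0 < X p → 0 < X q → p ≡ q × X p ≡ 1
    joins-unique connected _ _ p q jp jq pos-p pos-q with p ≟ q
    ... | yes refl = refl , ≤-antisym (multiplicity≤1 p) pos-p
    ... | no p≢q   = ⊥-elim (¬distinct-joining connected p≢q jp jq pos-p pos-q)

    ¬digon : UnderlyingConnected D → ∀ p q → 0 < X p → 0 < X q →
      ¬ (src p ≡ tgt q × tgt p ≡ src q)
    ¬digon connected p q pos-p pos-q (s , t) with p ≟ q
    ... | yes refl = ¬D-bypass pos-p (reflexive (ArcD D) s)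
    ... | no p≢q   =
      ¬antiparallel connected p≢q pos-p pos-q (reflexive (ArcD D) s) (reflexive (ArcD D) (sym t))

    isSolution : UnderlyingConnected D → IsSolution D X
    isSolution connected = record
      { multicompletion = proj₁ min
      ; isSet           = multiplicity≤1
      ; noLoopX         = λ p pos → ¬D-bypass pos ∘ reflexive (ArcD D)
      ; noParallelX     = λ p q pos-p pos-q p≢q (s , t) →
          ¬parallel p≢q pos-p pos-q (reflexive (ArcD D) (sym s)) (reflexive (ArcD D) t)
      ; noDigonX        = ¬digon connected
      } , stronglyConnected

lemma7 : (D : PlaneOrientedGraph) → UnderlyingConnected D →
    (X : Multi D) → MinimalSCMulticompletion D X →
    (∀ p → 0 < X p → ¬ SameSC D (PlaneOrientedGraph.dv D (proj₁ p)) (PlaneOrientedGraph.dv D (proj₂ p)))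
    × (∀ u v → ¬ SameSC D u v → ∀ p q → Joins D u v p → Joins D u v q →
         0 < X p → 0 < X q → p ≡ q × X p ≡ 1)
    × IsSolution D X
lemma7 D connected X min =
    (λ p pos → ¬D-bypass pos ∘ proj₁)
  , (λ u v _ → joins-unique connected u v)
  , isSolution connected
  where open MinimalCompletion.Minimal D min
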